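{- Let $\mathcal G$ be the graph with vertex set $V=(\mathbb{N}\times\mathbb{N})\setminus\{(0,0)\}$ (where $\mathbb{N}=\{0,1,2,\dots\}$), in which two distinct vertices $(a,b),(c,d)$ are adjacent if and only if $a=c=0$, or $b=d=0$, or ($a<c$ and $b>d$), or ($a>c$ and $b<d$). Then $\mathcal G$ is cop-win. Furthermore, for any two vertices $u,v$ of $\mathcal G$ there exists $n\in\mathbb{N}$ such that if the cop starts at $v$ and the robber starts at $u$, the cop can catch the robber in at most $n$ turns. However, there is no $n\in\mathbb{N}$ such that this holds for all pairs of initial positions $u,v$.
   Context: The game of cops and robbers on a graph $G$: the cop chooses a starting vertex, then the robber chooses a starting vertex; then they alternately move, the cop moving first, where a move consists of moving to an adjacent vertex or staying put. The cop wins if at some point he occupies the same vertex as the robber. $G$ is cop-win if the cop has a winning strategy. -}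

module Defs where

open import Data.Nat using (ℕ; zero; suc; _<_; _>_; _≤_)
open import Data.Product using (Σ; _×_; _,_; proj₁; proj₂; ∃)
open import Data.Sum using (_⊎_)
open import Data.Vec using (Vec; _∷_; []; head)
open import Relation.Nullary using (¬_)
open import Relation.Binary.PropositionalEquality using (_≡_)

module CopsAndRobbers (V : Set) (Adj : V → V → Set) where

  Step : V → V → Set
  Step x y = x ≡ y ⊎ Adj x y

  -- In round k (k = 0,1,...)
  -- the cop moves c_k ↦ c_{k+1}, then the robber moves r_k ↦ r_{k+1}.
  -- Histories are stored as vectors, most recent position first.

  record CopStrategy : Set where
    field
      move  : (k : ℕ) → Vec V (suc k) → Vec V (suc k) → V
      legal : ∀ k cs rs → Step (head cs) (move k cs rs)

  record RobberStrategy : Set where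
    field
      move  : (k : ℕ) → Vec V (suc (suc k)) → Vec V (suc k) → V
      legal : ∀ k cs rs → Step (head rs) (move k cs rs)

  history : CopStrategy → RobberStrategy → (c₀ r₀ : V) →
            (k : ℕ) → Vec V (suc k) × Vec V (suc k)
  history σ ρ c₀ r₀ zero = (c₀ ∷ []) , (r₀ ∷ [])
  history σ ρ c₀ r₀ (suc k) with history σ ρ c₀ r₀ k
  ... | cs , rs =
    let c' = CopStrategy.move σ k cs rs
        r' = RobberStrategy.move ρ k (c' ∷ cs) rs
    in (c' ∷ cs) , (r' ∷ rs)

  copPos : CopStrategy → RobberStrategy → (c₀ r₀ : V) → ℕ → V
  copPos σ ρ c₀ r₀ k = head (proj₁ (history σ ρ c₀ r₀ k))

  robPos : CopStrategy → RobberStrategy → (c₀ r₀ : V) → ℕ → V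
  robPos σ ρ c₀ r₀ k = head (proj₂ (history σ ρ c₀ r₀ k))

  -- The robber is caught by the end of the cop's k-th turn: either the
  -- positions coincide after k rounds (this includes the robber's own move
  -- in round k-1, and the start when k = 0), or the cop's k-th move lands
  -- on the robber's current vertex.
  CaughtAt : CopStrategy → RobberStrategy → (c₀ r₀ : V) → ℕ → Set
  CaughtAt σ ρ c₀ r₀ k =
    copPos σ ρ c₀ r₀ k ≡ robPos σ ρ c₀ r₀ k
    ⊎ Σ ℕ (λ j → k ≡ suc j × copPos σ ρ c₀ r₀ k ≡ robPos σ ρ c₀ r₀ j)

  CaughtWithin : CopStrategy → RobberStrategy → (c₀ r₀ : V) → ℕ → Set
  CaughtWithin σ ρ c₀ r₀ n = Σ ℕ (λ k → k ≤ n × CaughtAt σ ρ c₀ r₀ k)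

  Caught : CopStrategy → RobberStrategy → (c₀ r₀ : V) → Set
  Caught σ ρ c₀ r₀ = Σ ℕ (λ k → CaughtAt σ ρ c₀ r₀ k)

  CopWin : Set
  CopWin = Σ V (λ c₀ → Σ CopStrategy (λ σ →
             (r₀ : V) (ρ : RobberStrategy) → Caught σ ρ c₀ r₀))

  CanCatchWithin : (v u : V) → ℕ → Set
  CanCatchWithin v u n =
    Σ CopStrategy (λ σ → (ρ : RobberStrategy) → CaughtWithin σ ρ v u n)

record Vtx : Set where
  constructor vtx
  field
    x : ℕ
    y : ℕ
    .nonzero : ¬ (x ≡ 0 × y ≡ 0)

open Vtx public

AdjG : Vtx → Vtx → Set
AdjG p q =
  ¬ (x p ≡ x q × y p ≡ y q) ×
  ( (x p ≡ 0 × x q ≡ 0)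
  ⊎ (y p ≡ 0 × y q ≡ 0)
  ⊎ (x p < x q × y p > y q)
  ⊎ (x p > x q × y p < y q))

open CopsAndRobbers Vtx AdjG public

-- Cop: capture when possible, otherwise climb the y-axis to a point (0, h) above the robber.
-- A robber who then escapes capture must move above h without landing on the y-axis, and
-- every edge going up off the axis also goes strictly left, so the robber's x-coordinate is
-- a strictly decreasing clock.  Robber, started at (n + 2, n + 2) against a cop at (0, 1):
-- wherever the cop moves, one of "stay", "one step left and far up" and "one step down and
-- far right" is comparable with the cop's vertex in the product order, and comparable
-- vertices off the axes are never adjacent; each such move lowers min(x, y) by at most one,
-- so the robber survives n rounds.
module Submission where

import Defs
open import Data.Nat using (ℕ; zero; suc; pred; _+_; _∸_; _≤_; _<_; z≤n; s≤s; _≟_; _<?_)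
open import Data.Nat.Properties
open import Data.Product using (Σ; _×_; _,_; proj₁; proj₂; uncurry)
open import Data.Sum using (_⊎_; inj₁; inj₂)
open import Data.Empty using (⊥-elim)
open import Data.Vec using (head; _∷_)
open import Relation.Nullary using (¬_; Dec; yes; no)
open import Relation.Nullary.Decidable using (map′; ¬?; _×-dec_; _⊎-dec_)
open import Relation.Binary.PropositionalEquality using (_≡_; _≢_; refl; trans; cong; subst)

module CopsAndRobbersProperties (V : Set) (Adj : V → V → Set) where

  open Defs.CopsAndRobbers V Adj

  memorylessCop : (f : V → V → V) → (∀ c r → Step c (f c r)) → CopStrategy
  memorylessCop f legal = record
    { move  = λ _ cs rs → f (head cs) (head rs)
    ; legal = λ _ cs rs → legal (head cs) (head rs)
    }

  memorylessRobber : (f : V → V → V) → (∀ c r → Step r (f c r)) → RobberStrategy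
  memorylessRobber f legal = record
    { move  = λ _ cs rs → f (head cs) (head rs)
    ; legal = λ _ cs rs → legal (head cs) (head rs)
    }

  module _ (σ : CopStrategy) (ρ : RobberStrategy) (c₀ r₀ : V) where

    copPos-step : ∀ k → Step (copPos σ ρ c₀ r₀ k) (copPos σ ρ c₀ r₀ (suc k))
    copPos-step k = CopStrategy.legal σ k (proj₁ h) (proj₂ h)
      where h = history σ ρ c₀ r₀ k

    robPos-step : ∀ k → Step (robPos σ ρ c₀ r₀ k) (robPos σ ρ c₀ r₀ (suc k))
    robPos-step k =
      RobberStrategy.legal ρ k (copPos σ ρ c₀ r₀ (suc k) ∷ proj₁ h) (proj₂ h)
      where h = history σ ρ c₀ r₀ k

    caughtWithin-suc : ∀ {j n} → j ≤ n →
      copPos σ ρ c₀ r₀ (suc j) ≡ robPos σ ρ c₀ r₀ j → CaughtWithin σ ρ c₀ r₀ (suc n)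
    caughtWithin-suc {j} j≤n e = suc j , s≤s j≤n , inj₂ (j , refl , e)

    caughtWithin⇒caught : ∀ {n} → CaughtWithin σ ρ c₀ r₀ n → Caught σ ρ c₀ r₀
    caughtWithin⇒caught (k , _ , caught) = k , caught

    outOfReach⇒uncaughtWithin : ∀ n →
      (∀ k → k ≤ n → ¬ Step (copPos σ ρ c₀ r₀ k) (robPos σ ρ c₀ r₀ k)) →
      ¬ CaughtWithin σ ρ c₀ r₀ n
    outOfReach⇒uncaughtWithin n far (k , k≤n , inj₁ e) = far k k≤n (inj₁ e)
    outOfReach⇒uncaughtWithin n far (.(suc j) , k≤n , inj₂ (j , refl , e)) =
      far j (<⇒≤ k≤n) (subst (Step _) e (copPos-step j))

open Defs
open CopsAndRobbersProperties Vtx AdjG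

vtx-≡ : ∀ {P Q} → x P ≡ x Q → y P ≡ y Q → P ≡ Q
vtx-≡ refl refl = refl

_≟ᵥ_ : (P Q : Vtx) → Dec (P ≡ Q)
P ≟ᵥ Q = map′ (uncurry vtx-≡) (λ e → cong x e , cong y e) (x P ≟ x Q ×-dec y P ≟ y Q)

adj? : (P Q : Vtx) → Dec (AdjG P Q)
adj? P Q =
  ¬? (x P ≟ x Q ×-dec y P ≟ y Q) ×-dec
  ( (x P ≟ 0 ×-dec x Q ≟ 0)
  ⊎-dec (y P ≟ 0 ×-dec y Q ≟ 0)
  ⊎-dec (x P <? x Q ×-dec y Q <? y P)
  ⊎-dec (x Q <? x P ×-dec y P <? y Q))

step? : (P Q : Vtx) → Dec (Step P Q)
step? P Q = P ≟ᵥ Q ⊎-dec adj? P Q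

up-left-step : ∀ {P Q} → y P < y Q → x Q < x P ⊎ (x P ≡ 0 × x Q ≡ 0) → Step P Q
up-left-step y< (inj₁ x<)  = inj₂ ((λ (_ , e) → <⇒≢ y< e) , inj₂ (inj₂ (inj₂ (x< , y<))))
up-left-step y< (inj₂ x≡0) = inj₂ ((λ (_ , e) → <⇒≢ y< e) , inj₁ x≡0)

right-down-step : ∀ {P Q} → x P < x Q → y Q < y P ⊎ (y P ≡ 0 × y Q ≡ 0) → Step P Q
right-down-step x< (inj₁ y<)  = inj₂ ((λ (e , _) → <⇒≢ x< e) , inj₂ (inj₂ (inj₁ (x< , y<))))
right-down-step x< (inj₂ y≡0) = inj₂ ((λ (e , _) → <⇒≢ x< e) , inj₂ (inj₁ y≡0))

rising-step-goes-left : ∀ {R R'} → Step R R' → y R < y R' → 0 < x R' → x R' < x R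
rising-step-goes-left (inj₁ refl)                              y<  _   = ⊥-elim (<-irrefl refl y<)
rising-step-goes-left (inj₂ (_ , inj₁ (_ , x≡0)))              _   0<x = ⊥-elim (n>0⇒n≢0 0<x x≡0)
rising-step-goes-left (inj₂ (_ , inj₂ (inj₁ (_ , y≡0))))       y<  _   = ⊥-elim (n>0⇒n≢0 (≤-trans (s≤s z≤n) y<) y≡0)
rising-step-goes-left (inj₂ (_ , inj₂ (inj₂ (inj₁ (_ , y>))))) y<  _   = ⊥-elim (<-asym y< y>)
rising-step-goes-left (inj₂ (_ , inj₂ (inj₂ (inj₂ (x> , _))))) _   _   = x>

comparable-¬step : ∀ {P Q} → P ≢ Q → 0 < x Q × 0 < y Q →
  (x P ≤ x Q × y P ≤ y Q) ⊎ (x Q ≤ x P × y Q ≤ y P) → ¬ Step P Q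
comparable-¬step P≢Q _ _ (inj₁ P≡Q) = P≢Q P≡Q
comparable-¬step _ (0<x , _) _ (inj₂ (_ , inj₁ (_ , x≡0)))        = n>0⇒n≢0 0<x x≡0
comparable-¬step _ (_ , 0<y) _ (inj₂ (_ , inj₂ (inj₁ (_ , y≡0)))) = n>0⇒n≢0 0<y y≡0
comparable-¬step _ _ (inj₁ (_ , y≤)) (inj₂ (_ , inj₂ (inj₂ (inj₁ (_ , y>))))) = <⇒≱ y> y≤
comparable-¬step _ _ (inj₂ (x≤ , _)) (inj₂ (_ , inj₂ (inj₂ (inj₁ (x< , _))))) = <⇒≱ x< x≤
comparable-¬step _ _ (inj₁ (x≤ , _)) (inj₂ (_ , inj₂ (inj₂ (inj₂ (x> , _))))) = <⇒≱ x> x≤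
comparable-¬step _ _ (inj₂ (_ , y≤)) (inj₂ (_ , inj₂ (inj₂ (inj₂ (_ , y<))))) = <⇒≱ y< y≤

climb : Vtx → Vtx → Vtx
climb C R = vtx 0 (suc (y C + y R)) λ { (_ , ()) }

climb-step : ∀ C R → Step C (climb C R)
climb-step (vtx zero    b _) R = up-left-step (s≤s (m≤m+n b (y R))) (inj₂ (refl , refl))
climb-step (vtx (suc a) b _) R = up-left-step (s≤s (m≤m+n b (y R))) (inj₁ (s≤s z≤n))

¬step-from-axis : ∀ {C R} → x C ≡ 0 → ¬ Step C R → 0 < x R × y C ≤ y R
¬step-from-axis {vtx .0 c _} {vtx zero b _} refl C↛R with c ≟ b
... | yes refl = ⊥-elim (C↛R (inj₁ refl))
... | no  c≢b  = ⊥-elim (C↛R (inj₂ ((λ (_ , e) → c≢b e) , inj₁ (refl , refl))))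
¬step-from-axis {vtx .0 c _} {vtx (suc a) b _} refl C↛R with b <? c
... | yes b<c = ⊥-elim (C↛R (right-down-step (s≤s z≤n) (inj₁ b<c)))
... | no  b≮c = s≤s z≤n , ≮⇒≥ b≮c

Above : Vtx → Vtx → Set
Above C R = x C ≡ 0 × y R < y C

-- Kept opaque: unfolding pursue inside the positions of a play makes Agda evaluate step?
-- along the whole history, and type checking the pursuit invariant blows up.
opaque
  pursue : Vtx → Vtx → Vtx
  pursue C R with step? C R
  ... | yes _ = R
  ... | no  _ = climb C R

  pursue-step : ∀ C R → Step C (pursue C R)
  pursue-step C R with step? C R
  ... | yes C→R = C→R
  ... | no  _   = climb-step C R

  pursue-catches-or-climbs : ∀ C R → pursue C R ≡ R ⊎ Above (pursue C R) R
  pursue-catches-or-climbs C R with step? C R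
  ... | yes _ = inj₁ refl
  ... | no  _ = inj₂ (refl , s≤s (m≤n+m (y R) (y C)))

  pursue-from-above : ∀ {C R R'} → Above C R → Step R R' →
    pursue C R' ≡ R' ⊎ (x R' < x R × Above (pursue C R') R')
  pursue-from-above {C} {R} {R'} (x≡0 , R<C) R→R' with step? C R'
  ... | yes _    = inj₁ refl
  ... | no C↛R' =
    let (0<x , C≤R') = ¬step-from-axis x≡0 C↛R'
    in  inj₂ (rising-step-goes-left R→R' (<-≤-trans R<C C≤R') 0<x , refl , s≤s (m≤n+m (y R') (y C)))

pursuer : CopStrategy
pursuer = memorylessCop pursue pursue-step

module _ (ρ : RobberStrategy) (v u : Vtx) where

  private
    C R : ℕ → Vtx
    C = copPos pursuer ρ v u
    R = robPos pursuer ρ v u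

  pursuit-invariant : ∀ k →
    (Σ ℕ λ j → j ≤ k × C (suc j) ≡ R j) ⊎ (Above (C (suc k)) (R k) × x (R k) + k ≤ x u)
  pursuit-invariant zero with pursue-catches-or-climbs v u
  ... | inj₁ caught = inj₁ (0 , z≤n , caught)
  ... | inj₂ above  = inj₂ (above , ≤-reflexive (+-identityʳ (x u)))
  pursuit-invariant (suc k) with pursuit-invariant k
  ... | inj₁ (j , j≤k , caught) = inj₁ (j , m≤n⇒m≤1+n j≤k , caught)
  ... | inj₂ (above , bound) with pursue-from-above {C (suc k)} above (robPos-step pursuer ρ v u k)
  ...   | inj₁ caught        = inj₁ (suc k , ≤-refl , caught)
  ...   | inj₂ (x< , above') =
    inj₂ (above' , ≤-trans (≤-reflexive (+-suc (x (R (suc k))) k)) (≤-trans (+-monoˡ-≤ k x<) bound))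

  pursuer-catches : CaughtWithin pursuer ρ v u (2 + x u)
  pursuer-catches with pursuit-invariant (suc (x u))
  ... | inj₁ (j , j≤ , caught) = caughtWithin-suc pursuer ρ v u j≤ caught
  ... | inj₂ (_ , bound)       = ⊥-elim (1+n≰n (m+n≤o⇒n≤o (x (R (suc (x u)))) bound))

record Deep (m : ℕ) (R : Vtx) : Set where
  constructor _,_
  field
    x-deep : 2 + m ≤ x R
    y-deep : 2 + m ≤ y R

deep-off-axes : ∀ {m R} → Deep m R → 0 < x R × 0 < y R
deep-off-axes (dx , dy) = ≤-trans (s≤s z≤n) dx , ≤-trans (s≤s z≤n) dy

west : Vtx → ℕ → Vtx
west R h = vtx (pred (x R)) (suc (y R + h)) λ { (_ , ()) }

south : Vtx → ℕ → Vtx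
south R w = vtx (suc (x R + w)) (pred (y R)) λ { (() , _) }

west-step : ∀ R h → Step R (west R h)
west-step (vtx zero    b _) h = up-left-step (s≤s (m≤m+n b h)) (inj₂ (refl , refl))
west-step (vtx (suc a) b _) h = up-left-step (s≤s (m≤m+n b h)) (inj₁ ≤-refl)

south-step : ∀ R w → Step R (south R w)
south-step (vtx a zero    _) w = right-down-step (s≤s (m≤m+n a w)) (inj₂ (refl , refl))
south-step (vtx a (suc b) _) w = right-down-step (s≤s (m≤m+n a w)) (inj₁ ≤-refl)

west-deep : ∀ {m R} h → Deep (suc m) R → Deep m (west R h)
west-deep {R = R} h (dx , dy) =
  pred-mono-≤ dx , ≤-trans (n≤1+n _) (≤-trans dy (m≤n⇒m≤1+n (m≤m+n (y R) h)))

south-deep : ∀ {m R} w → Deep (suc m) R → Deep m (south R w)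
south-deep {R = R} w (dx , dy) =
  ≤-trans (n≤1+n _) (≤-trans dx (m≤n⇒m≤1+n (m≤m+n (x R) w))) , pred-mono-≤ dy

west-safe : ∀ {m P R} → Deep (suc m) R → x P < x R →
  ¬ Step P (west R (y P)) × Deep m (west R (y P))
west-safe {m} {P} {R} deep xP<xR =
  comparable-¬step (λ e → <⇒≢ yP<yQ (cong y e)) (deep-off-axes deep')
    (inj₁ (<⇒≤pred xP<xR , <⇒≤ yP<yQ)) , deep'
  where
  yP<yQ : y P < suc (y R + y P)
  yP<yQ = s≤s (m≤n+m (y P) (y R))
  deep' : Deep m (west R (y P))
  deep' = west-deep (y P) deep

south-safe : ∀ {m P R} → Deep (suc m) R → y P < y R →
  ¬ Step P (south R (x P)) × Deep m (south R (x P))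
south-safe {m} {P} {R} deep yP<yR =
  comparable-¬step (λ e → <⇒≢ xP<xQ (cong x e)) (deep-off-axes deep')
    (inj₁ (<⇒≤ xP<xQ , <⇒≤pred yP<yR)) , deep'
  where
  xP<xQ : x P < suc (x R + x P)
  xP<xQ = s≤s (m≤n+m (x P) (x R))
  deep' : Deep m (south R (x P))
  deep' = south-deep (x P) deep

stay-safe : ∀ {m P R} → Deep (suc m) R → P ≢ R → x R ≤ x P → y R ≤ y P → ¬ Step P R × Deep m R
stay-safe deep@(dx , dy) P≢R xR≤xP yR≤yP =
  comparable-¬step P≢R (deep-off-axes deep) (inj₂ (xR≤xP , yR≤yP)) , <⇒≤ dx , <⇒≤ dy

flee : Vtx → Vtx → Vtx
flee P R with x P <? x R | y P <? y R
... | yes _ | _     = west R (y P)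
... | no  _ | yes _ = south R (x P)
... | no  _ | no  _ = R

flee-step : ∀ P R → Step R (flee P R)
flee-step P R with x P <? x R | y P <? y R
... | yes _ | _     = west-step R (y P)
... | no  _ | yes _ = south-step R (x P)
... | no  _ | no  _ = inj₁ refl

flee-safe : ∀ {m P R} → Deep (suc m) R → P ≢ R → ¬ Step P (flee P R) × Deep m (flee P R)
flee-safe {P = P} {R} deep P≢R with x P <? x R | y P <? y R
... | yes xP<xR | _         = west-safe deep xP<xR
... | no  _     | yes yP<yR = south-safe deep yP<yR
... | no  xP≮xR | no  yP≮yR = stay-safe deep P≢R (≮⇒≥ xP≮xR) (≮⇒≥ yP≮yR)

evader : RobberStrategy
evader = memorylessRobber flee flee-step

evader-survives : ∀ σ {v u} n → ¬ Step v u → Deep n u → ¬ CaughtWithin σ evader v u n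
evader-survives σ {v} {u} n v↛u u-deep =
  outOfReach⇒uncaughtWithin σ evader v u n λ k k≤n → proj₁ (evasion k (n ∸ k) (m+[n∸m]≡n k≤n))
  where
  C R : ℕ → Vtx
  C = copPos σ evader v u
  R = robPos σ evader v u

  evasion : ∀ k m → k + m ≡ n → ¬ Step (C k) (R k) × Deep m (R k)
  evasion zero    m refl = v↛u , u-deep
  evasion (suc k) m eq with evasion k (suc m) (trans (+-suc k m) eq)
  ... | C↛R , deep = flee-safe deep λ C′≡R → C↛R (subst (Step (C k)) C′≡R (copPos-step σ evader v u k))

base : Vtx
base = vtx 0 1 λ { (_ , ()) }

corner : ℕ → Vtx
corner n = vtx (2 + n) (2 + n) λ { (() , _) }

base↛corner : ∀ n → ¬ Step base (corner n)
base↛corner n = comparable-¬step (λ ()) (s≤s z≤n , s≤s z≤n) (inj₁ (z≤n , s≤s z≤n))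

theorem1 : CopWin
           × ((u v : Vtx) → Σ ℕ (λ n → CanCatchWithin v u n))
           × ¬ (Σ ℕ (λ n → (u v : Vtx) → CanCatchWithin v u n))
theorem1 =
  (base , pursuer , λ u ρ → caughtWithin⇒caught pursuer ρ base u (pursuer-catches ρ base u))
  , (λ u v → 2 + x u , pursuer , λ ρ → pursuer-catches ρ v u)
  , λ (n , uniform) →
      let (σ , catches) = uniform (corner n) base
      in  evader-survives σ n (base↛corner n) (≤-refl , ≤-refl) (catches evader)
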